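{- For every integer $m\geq 3$, the graph $C_m[4]$ has a $C_m$-factorization.
   Context: For a graph $G$ and integer $k\geq 1$, $G[k]$ denotes the graph with vertex set $V(G)\times\{0,1,\dots,k-1\}$ in which $(u,i)$ and $(w,j)$ are adjacent if and only if $uw\in E(G)$. $C_m$ is the cycle of length $m$. A $C_\ell$-factor of a graph is a spanning subgraph that is a vertex-disjoint union of $\ell$-cycles; a $C_\ell$-factorization is a partition of the edge set into $C_\ell$-factors. -}

module Defs where

open import Data.Nat using (ℕ; zero; suc)
open import Data.Nat.DivMod using (_mod_)
open import Data.Fin using (Fin; toℕ)
open import Data.Product using (_×_; _,_; proj₁; ∃; ∃-syntax)
open import Data.Sum using (_⊎_)
open import Relation.Binary.PropositionalEquality using (_≡_)
open import Function.Definitions using (Injective)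

-- A (simple, undirected) graph on a vertex type V is given by its adjacency relation.

next : ∀ {n} → Fin n → Fin n
next {suc n} i = suc (toℕ i) mod (suc n)

CycleAdj : (n : ℕ) → Fin n → Fin n → Set
CycleAdj n i j = (j ≡ next i) ⊎ (i ≡ next j)

-- lexicographic blow-up  G[k] : vertex set V × Fin k,
-- (u , a) ~ (w , b)  iff  u ~ w in G
Lex : {V : Set} → (V → V → Set) → (k : ℕ) → (V × Fin k) → (V × Fin k) → Set
Lex E k x y = E (proj₁ x) (proj₁ y)

record CycleIn {V : Set} (E : V → V → Set) (ℓ : ℕ) : Set where
  field
    vert : Fin ℓ → V
    inj  : Injective _≡_ _≡_ vert
    adj  : ∀ i → E (vert i) (vert (next i))
open CycleIn public

CycleEdge : {V : Set} {E : V → V → Set} {ℓ : ℕ} → CycleIn E ℓ → V → V → Set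
CycleEdge c u v = ∃[ i ] ((vert c i ≡ u × vert c (next i) ≡ v) ⊎ (vert c i ≡ v × vert c (next i) ≡ u))

record Factor {V : Set} (E : V → V → Set) (ℓ : ℕ) : Set where
  field
    ncyc     : ℕ
    cyc      : Fin ncyc → CycleIn E ℓ
    spanning : ∀ v → ∃[ j ] ∃[ i ] (vert (cyc j) i ≡ v)
    disjoint : ∀ j j' i i' → vert (cyc j) i ≡ vert (cyc j') i' → j ≡ j'
open Factor public

FactorEdge : {V : Set} {E : V → V → Set} {ℓ : ℕ} → Factor E ℓ → V → V → Set
FactorEdge F u v = ∃[ j ] CycleEdge (cyc F j) u v

record Factorization {V : Set} (E : V → V → Set) (ℓ : ℕ) : Set where
  field
    nfac     : ℕ
    fac      : Fin nfac → Factor E ℓ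
    covers   : ∀ u v → E u v → ∃[ j ] FactorEdge (fac j) u v
    disjoint : ∀ j j' u v → FactorEdge (fac j) u v → FactorEdge (fac j') u v → j ≡ j'

module Submission where

-- Give the columns 0, …, m-1 of C_m[k] a proper colouring χ, and to every colour t a square
-- L_t : rows × columns → layers of order k whose rows are permutations and any two of which
-- are orthogonal.  For each row f, the k cycles  i ↦ (i , L_{χ i} f c)  (one for every c)
-- form a C_m-factor, since row f of each L_t is a permutation.  An edge between layer a of
-- column i and layer b of column i+1 lies in exactly one of these cycles, because the cells
-- of two orthogonal squares are determined by their pair of entries (a , b).  Three colours
-- suffice for a cycle, and over GF(4) the squares  L_t f c = c + t f  for t ∈ {0, 1, ω}
-- are pairwise orthogonal, as (f , c) ↦ (c + t f , c + t' f) is invertible when t ≠ t'.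

open import Defs
open import Data.Nat using (ℕ; zero; suc; _%_; _≤_; s≤s; z≤n)
open import Data.Nat.DivMod using (n%n≡0; m<n⇒m%n≡m)
open import Data.Fin using (Fin; zero; suc; toℕ; fromℕ; inject₁; _≟_)
open import Data.Fin.Patterns using (0F; 1F; 2F; 3F)
open import Data.Fin.Properties using (toℕ-injective; toℕ-fromℕ<; toℕ-fromℕ; toℕ-inject₁; toℕ<n; all?; any?)
open import Data.Product using (_×_; _,_; proj₁; proj₂; ∃; ∃-syntax)
open import Data.Product.Properties using (≡-dec)
open import Data.Sum using (inj₁; inj₂)
open import Function using (_∘_)
open import Function.Definitions using (Injective; StrictlySurjective)
open import Relation.Binary.Definitions using (DecidableEquality)
open import Relation.Nullary using (Dec; ¬?)
open import Relation.Nullary.Decidable using (map′; from-yes; _×-dec_; _→-dec_)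
open import Relation.Binary.PropositionalEquality using (_≡_; refl; sym; trans; cong; cong₂; subst; _≢_; module ≡-Reasoning)

Exhaustible : Set → Set₁
Exhaustible A = {P : A → Set} → (∀ x → Dec (P x)) → Dec (∀ x → P x)

Searchable : Set → Set₁
Searchable A = {P : A → Set} → (∀ x → Dec (P x)) → Dec (∃ P)

exhaustible-× : ∀ {A B} → Exhaustible A → Exhaustible B → Exhaustible (A × B)
exhaustible-× ∀A? ∀B? P? =
  map′ (λ h (x , y) → h x y) (λ h x y → h (x , y)) (∀A? λ x → ∀B? λ y → P? (x , y))

searchable-× : ∀ {A B} → Searchable A → Searchable B → Searchable (A × B)
searchable-× ∃A? ∃B? P? =
  map′ (λ { (x , y , p) → (x , y) , p }) (λ { ((x , y) , p) → x , y , p })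
       (∃A? λ x → ∃B? λ y → P? (x , y))

injective? : ∀ {A B} → Exhaustible A → DecidableEquality A → DecidableEquality B →
             (g : A → B) → Dec (Injective _≡_ _≡_ g)
injective? ∀A? _≟A_ _≟B_ g =
  map′ (λ h {x} {y} → h x y) (λ h x y → h)
       (∀A? λ x → ∀A? λ y → (g x ≟B g y) →-dec (x ≟A y))

strictlySurjective? : ∀ {A B} → Searchable A → Exhaustible B → DecidableEquality B →
                      (g : A → B) → Dec (StrictlySurjective _≡_ g)
strictlySurjective? ∃A? ∀B? _≟B_ g = ∀B? λ y → ∃A? λ x → g x ≟B y

Square : ℕ → Set
Square k = Fin k → Fin k → Fin k

RowLatin : ∀ {k} → Square k → Set
RowLatin L = ∀ f → Injective _≡_ _≡_ (L f) × StrictlySurjective _≡_ (L f)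

superpose : ∀ {k} → Square k → Square k → Fin k × Fin k → Fin k × Fin k
superpose L L' (f , c) = L f c , L' f c

Orthogonal : ∀ {k} → Square k → Square k → Set
Orthogonal L L' = Injective _≡_ _≡_ (superpose L L') × StrictlySurjective _≡_ (superpose L L')

record OrthogonalFamily (k : ℕ) (T : Set) : Set where
  field
    square     : T → Square k
    row-latin  : ∀ t → RowLatin (square t)
    orthogonal : ∀ {t t'} → t ≢ t' → Orthogonal (square t) (square t')

rowLatin? : ∀ {k} (L : Square k) → Dec (RowLatin L)
rowLatin? L = all? λ f →
  injective? all? _≟_ _≟_ (L f) ×-dec strictlySurjective? any? all? _≟_ (L f)

orthogonal? : ∀ {k} (L L' : Square k) → Dec (Orthogonal L L')
orthogonal? L L' =
  injective? (exhaustible-× all? all?) (≡-dec _≟_ _≟_) (≡-dec _≟_ _≟_) (superpose L L')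
  ×-dec strictlySurjective? (searchable-× any? any?) (exhaustible-× all? all?)
                    (≡-dec _≟_ _≟_) (superpose L L')

ProperColouring : ∀ {T : Set} (m : ℕ) → (Fin m → T) → Set
ProperColouring m χ = ∀ i → χ i ≢ χ (next i)

next-fromℕ : ∀ n → next (fromℕ n) ≡ zero
next-fromℕ n = toℕ-injective (begin
  toℕ (next (fromℕ n))      ≡⟨ toℕ-fromℕ< _ ⟩
  suc (toℕ (fromℕ n)) % suc n ≡⟨ cong (λ x → suc x % suc n) (toℕ-fromℕ n) ⟩
  suc n % suc n              ≡⟨ n%n≡0 (suc n) ⟩
  0                          ∎)
  where open ≡-Reasoning

next-inject₁ : ∀ {n} (j : Fin n) → next (inject₁ j) ≡ suc j
next-inject₁ {n} j = toℕ-injective (begin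
  toℕ (next (inject₁ j))      ≡⟨ toℕ-fromℕ< _ ⟩
  suc (toℕ (inject₁ j)) % suc n ≡⟨ cong (λ x → suc x % suc n) (toℕ-inject₁ j) ⟩
  suc (toℕ j) % suc n          ≡⟨ m<n⇒m%n≡m (s≤s (toℕ<n j)) ⟩
  suc (toℕ j)                  ∎)
  where open ≡-Reasoning

data LastOrInject₁ : ∀ {n} → Fin (suc n) → Set where
  is-last    : ∀ {n} → LastOrInject₁ (fromℕ n)
  is-inject₁ : ∀ {n} (j : Fin n) → LastOrInject₁ (inject₁ j)

lastOrInject₁ : ∀ {n} (i : Fin (suc n)) → LastOrInject₁ i
lastOrInject₁ {zero}  zero    = is-last
lastOrInject₁ {suc n} zero    = is-inject₁ zero
lastOrInject₁ {suc n} (suc i) with lastOrInject₁ i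
... | is-last      = is-last
... | is-inject₁ j = is-inject₁ (suc j)

-- x and y alternate along 0, …, n-1 (they swap roles at each step); the last vertex n gets z.
alternating : ∀ {T : Set} → T → T → T → (n : ℕ) → Fin (suc n) → T
alternating x y z zero    zero    = z
alternating x y z (suc n) zero    = x
alternating x y z (suc n) (suc i) = alternating y x z n i

alternating-fromℕ : ∀ {T : Set} (x y z : T) n → alternating x y z n (fromℕ n) ≡ z
alternating-fromℕ x y z zero    = refl
alternating-fromℕ x y z (suc n) = alternating-fromℕ y x z n

alternating-step : ∀ {T : Set} {x y z : T} → x ≢ y → y ≢ z → z ≢ x →
                   ∀ n (j : Fin n) → alternating x y z n (inject₁ j) ≢ alternating x y z n (suc j)
alternating-step x≢y y≢z z≢x (suc zero)    zero    = z≢x ∘ sym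
alternating-step x≢y y≢z z≢x (suc (suc n)) zero    = x≢y
alternating-step x≢y y≢z z≢x (suc n)       (suc j) =
  alternating-step (x≢y ∘ sym) (z≢x ∘ sym) (y≢z ∘ sym) n j

alternating-proper : ∀ {T : Set} {x y z : T} → x ≢ y → y ≢ z → z ≢ x →
                     ∀ n → ProperColouring (suc (suc n)) (alternating x y z (suc n))
alternating-proper {x = x} {y} {z} x≢y y≢z z≢x n i with lastOrInject₁ i
... | is-last      rewrite next-fromℕ (suc n) | alternating-fromℕ x y z (suc n) = z≢x
... | is-inject₁ j rewrite next-inject₁ j = alternating-step x≢y y≢z z≢x (suc n) j

module _ {k m : ℕ} {T : Set} (O : OrthogonalFamily k T)
         (χ : Fin m → T) (χ-proper : ProperColouring m χ) where

  open OrthogonalFamily O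

  vertexOf : Fin k → Fin k → Fin m → Fin m × Fin k
  vertexOf f c i = i , square (χ i) f c

  cellCycle : Fin k → Fin k → CycleIn (Lex (CycleAdj m) k) m
  cellCycle f c = record
    { vert = vertexOf f c
    ; inj  = cong proj₁
    ; adj  = λ _ → inj₁ refl
    }

  realign : ∀ {f c f' c' i j} → vertexOf f c i ≡ vertexOf f' c' j → vertexOf f c j ≡ vertexOf f' c' j
  realign {f} {c} {f'} {c'} {j = j} e = subst (λ x → vertexOf f c x ≡ vertexOf f' c' j) (cong proj₁ e) e

  same-row : ∀ {f c f' c'} i → vertexOf f c i ≡ vertexOf f' c' i →
             vertexOf f c (next i) ≡ vertexOf f' c' (next i) → f ≡ f'
  same-row i e e' = cong proj₁ (proj₁ (orthogonal (χ-proper i)) (cong₂ _,_ (cong proj₂ e) (cong proj₂ e')))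

  rowFactor : Fin k → Factor (Lex (CycleAdj m) k) m
  rowFactor f = record
    { ncyc     = k
    ; cyc      = cellCycle f
    ; spanning = covering
    ; disjoint = λ c c' i i' e → proj₁ (row-latin (χ i') f) (cong proj₂ (realign e))
    }
    where
    covering : ∀ v → ∃[ c ] ∃[ i ] vertexOf f c i ≡ v
    covering (i , a) with proj₂ (row-latin (χ i) f) a
    ... | c , e = c , i , cong (i ,_) e

  edge-in-row : ∀ u v → Lex (CycleAdj m) k u v → ∃[ f ] FactorEdge (rowFactor f) u v
  edge-in-row (i , a) (_ , b) (inj₁ refl) with proj₂ (orthogonal (χ-proper i)) (a , b)
  ... | (f , c) , e = f , c , i , inj₁ (cong (i ,_) (cong proj₁ e) , cong (next i ,_) (cong proj₂ e))
  edge-in-row (_ , a) (i , b) (inj₂ refl) with proj₂ (orthogonal (χ-proper i)) (b , a)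
  ... | (f , c) , e = f , c , i , inj₂ (cong (i ,_) (cong proj₁ e) , cong (next i ,_) (cong proj₂ e))

  edge-row-unique : ∀ f f' u v → FactorEdge (rowFactor f) u v → FactorEdge (rowFactor f') u v → f ≡ f'
  edge-row-unique f f' u v (c , i , inj₁ (p , q)) (c' , i' , inj₁ (p' , q')) =
    same-row i' (realign (trans p (sym p'))) (realign (trans q (sym q')))
  edge-row-unique f f' u v (c , i , inj₁ (p , q)) (c' , i' , inj₂ (p' , q')) =
    same-row i' (realign (trans q (sym p'))) (realign (trans p (sym q')))
  edge-row-unique f f' u v (c , i , inj₂ (p , q)) (c' , i' , inj₁ (p' , q')) =
    same-row i' (realign (trans q (sym p'))) (realign (trans p (sym q')))
  edge-row-unique f f' u v (c , i , inj₂ (p , q)) (c' , i' , inj₂ (p' , q')) =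
    same-row i' (realign (trans p (sym p'))) (realign (trans q (sym q')))

  lex-cycle-factorization : Factorization (Lex (CycleAdj m) k) m
  lex-cycle-factorization = record
    { nfac     = k
    ; fac      = rowFactor
    ; covers   = edge-in-row
    ; disjoint = edge-row-unique
    }

-- GF(4) = {0, 1, ω, ω²} encoded as 0F, 1F, 2F, 3F; since ω² = 1 + ω, addition is bitwise xor.

GF4 : Set
GF4 = Fin 4

infixl 6 _⊕_
infixl 7 _⊗_

_⊕_ : GF4 → GF4 → GF4
0F ⊕ y  = y
x  ⊕ 0F = x
1F ⊕ 1F = 0F
1F ⊕ 2F = 3F
1F ⊕ 3F = 2F
2F ⊕ 1F = 3F
2F ⊕ 2F = 0F
2F ⊕ 3F = 1F
3F ⊕ 1F = 2F
3F ⊕ 2F = 1F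
3F ⊕ 3F = 0F

_⊗_ : GF4 → GF4 → GF4
0F ⊗ y  = 0F
1F ⊗ y  = y
x  ⊗ 0F = 0F
x  ⊗ 1F = x
2F ⊗ 2F = 3F
2F ⊗ 3F = 1F
3F ⊗ 2F = 1F
3F ⊗ 3F = 2F

affineSquare : GF4 → Square 4
affineSquare t f c = c ⊕ t ⊗ f

affineFamily : OrthogonalFamily 4 GF4
affineFamily = record
  { square     = affineSquare
  ; row-latin  = from-yes (all? λ t → rowLatin? (affineSquare t))
  ; orthogonal = λ {t} {t'} → from-yes (all? λ t → all? λ t' →
                   ¬? (t ≟ t') →-dec orthogonal? (affineSquare t) (affineSquare t')) t t'
  }

lemma6 : (m : ℕ) → 3 ≤ m → Factorization (Lex (CycleAdj m) 4) m
lemma6 (suc (suc (suc n))) (s≤s (s≤s (s≤s z≤n))) =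
  lex-cycle-factorization affineFamily (alternating 0F 1F 2F (suc (suc n)))
    (alternating-proper (λ ()) (λ ()) (λ ()) (suc n))
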